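{- Let $\mathcal{M}$ be a model of $\mathsf{HA}$. For every binary formula $\alpha(x,y)$ and every $n:\mathbb{N}$, $$\mathcal{M}\vDash\forall e\ \neg\neg\,\exists c\ \forall u<\overline{n}.\ \alpha(u,e)\leftrightarrow\Pi(u)\mid c.$$
   Context: Meta-theory: constructive type theory (Calculus of Inductive Constructions), no classical axioms assumed. Arithmetic signature $0,S,+,\times,=$; $\mathsf{HA}$ is Heyting arithmetic (axioms for successor disjointness/injectivity, recursion equations for $+$ and $\times$, equality axioms, induction scheme for all formulas, intuitionistic deduction); $\mathsf{Q}$ is Robinson arithmetic (same without induction, plus $\forall x.\,x=0\lor\exists y.\,x=Sy$). A model $\mathcal{M}$ of $\mathsf{HA}$ is a type with interpretations of $0,S,+,\times$, $=$ interpreted as actual equality, satisfying the $\mathsf{HA}$ axioms under Tarski semantics (connectives and quantifiers interpreted type-theoretically). $\overline{n}$ is the numeral $S^n0$; $x<y:=\exists k.\,S(x+k)=y$; $x\mid y:=\exists k.\,x\times k=y$. Let $\pi:\mathbb{N}\to\mathbb{N}$ be an injective function whose values are all primes, and let $\Pi(x,y)$ be a binary formula representing $\pi$ in $\mathsf{Q}$, i.e. $\mathsf{Q}\vdash\forall y.\,\Pi(\overline{n},y)\leftrightarrow\overline{\pi(n)}=y$ for all $n$ (such a $\Sigma_1$-formula exists under Church's thesis $\mathsf{CT_Q}$). $\Pi(u)\mid c$ abbreviates $\exists p.\,\Pi(u,p)\land p\mid c$. -}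

module Defs where

open import Data.Nat using (ℕ; zero; suc; _+_; _*_; _<_)
open import Data.List using (List; []; _∷_; map)
open import Data.List.Membership.Propositional using (_∈_)
open import Data.List.Relation.Unary.All using (All)
open import Data.Product using (Σ; Σ-syntax; _×_; _,_)
open import Data.Sum using (_⊎_)
open import Data.Empty using (⊥)
open import Relation.Binary.PropositionalEquality using (_≡_)

infixl 7 _⊗_
infixl 6 _⊕_
infix  4 _≐_
infixr 3 _∧f_
infixr 2 _∨f_
infixr 1 _⇒_
infix  1 _⇔_

data Term : Set where
  var  : ℕ → Term
  zer  : Term
  succ : Term → Term
  _⊕_  : Term → Term → Term
  _⊗_  : Term → Term → Term

data Form : Set where
  ⊥f   : Form
  _≐_  : Term → Term → Form
  _∧f_ : Form → Form → Form
  _∨f_ : Form → Form → Form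
  _⇒_  : Form → Form → Form
  ∀f   : Form → Form
  ∃f   : Form → Form

¬f_ : Form → Form
¬f φ = φ ⇒ ⊥f

_⇔_ : Form → Form → Form
φ ⇔ ψ = (φ ⇒ ψ) ∧f (ψ ⇒ φ)

num : ℕ → Term
num zero    = zer
num (suc n) = succ (num n)

Subst : Set
Subst = ℕ → Term

_·:_ : Term → Subst → Subst
(t ·: σ) zero    = t
(t ·: σ) (suc k) = σ k

_[_]t : Term → Subst → Term
var k   [ σ ]t = σ k
zer     [ σ ]t = zer
succ t  [ σ ]t = succ (t [ σ ]t)
(s ⊕ t) [ σ ]t = (s [ σ ]t) ⊕ (t [ σ ]t)
(s ⊗ t) [ σ ]t = (s [ σ ]t) ⊗ (t [ σ ]t)

↑ : Subst
↑ k = var (suc k)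

up : Subst → Subst
up σ zero    = var zero
up σ (suc k) = (σ k) [ ↑ ]t

_[_] : Form → Subst → Form
⊥f       [ σ ] = ⊥f
(s ≐ t)  [ σ ] = (s [ σ ]t) ≐ (t [ σ ]t)
(φ ∧f ψ) [ σ ] = (φ [ σ ]) ∧f (ψ [ σ ])
(φ ∨f ψ) [ σ ] = (φ [ σ ]) ∨f (ψ [ σ ])
(φ ⇒ ψ)  [ σ ] = (φ [ σ ]) ⇒ (ψ [ σ ])
∀f φ     [ σ ] = ∀f (φ [ up σ ])
∃f φ     [ σ ] = ∃f (φ [ up σ ])

shift : Form → Form
shift φ = φ [ ↑ ]

boundT : ℕ → Term → Set
boundT n (var k) = k < n
boundT n zer     = ⊤'
  where open import Data.Unit using () renaming (⊤ to ⊤')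
boundT n (succ t) = boundT n t
boundT n (s ⊕ t)  = boundT n s × boundT n t
boundT n (s ⊗ t)  = boundT n s × boundT n t

bound : ℕ → Form → Set
bound n ⊥f       = ⊤'
  where open import Data.Unit using () renaming (⊤ to ⊤')
bound n (s ≐ t)  = boundT n s × boundT n t
bound n (φ ∧f ψ) = bound n φ × bound n ψ
bound n (φ ∨f ψ) = bound n φ × bound n ψ
bound n (φ ⇒ ψ)  = bound n φ × bound n ψ
bound n (∀f φ)   = bound (suc n) φ
bound n (∃f φ)   = bound (suc n) φ

-- a binary formula α(x,y): free variables among x = $0, y = $1
Binary : Form → Set
Binary = bound 2

infix 0 _⊢_

data _⊢_ : List Form → Form → Set where
  ctx  : ∀ {Γ φ} → φ ∈ Γ → Γ ⊢ φ
  ⇒I   : ∀ {Γ φ ψ} → (φ ∷ Γ) ⊢ ψ → Γ ⊢ φ ⇒ ψ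
  ⇒E   : ∀ {Γ φ ψ} → Γ ⊢ φ ⇒ ψ → Γ ⊢ φ → Γ ⊢ ψ
  ∀I   : ∀ {Γ φ} → map shift Γ ⊢ φ → Γ ⊢ ∀f φ
  ∀E   : ∀ {Γ φ} (t : Term) → Γ ⊢ ∀f φ → Γ ⊢ φ [ t ·: var ]
  ∃I   : ∀ {Γ φ} (t : Term) → Γ ⊢ φ [ t ·: var ] → Γ ⊢ ∃f φ
  ∃E   : ∀ {Γ φ ψ} → Γ ⊢ ∃f φ → (φ ∷ map shift Γ) ⊢ shift ψ → Γ ⊢ ψ
  ⊥E   : ∀ {Γ φ} → Γ ⊢ ⊥f → Γ ⊢ φ
  ∧I   : ∀ {Γ φ ψ} → Γ ⊢ φ → Γ ⊢ ψ → Γ ⊢ φ ∧f ψ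
  ∧E₁  : ∀ {Γ φ ψ} → Γ ⊢ φ ∧f ψ → Γ ⊢ φ
  ∧E₂  : ∀ {Γ φ ψ} → Γ ⊢ φ ∧f ψ → Γ ⊢ ψ
  ∨I₁  : ∀ {Γ φ ψ} → Γ ⊢ φ → Γ ⊢ φ ∨f ψ
  ∨I₂  : ∀ {Γ φ ψ} → Γ ⊢ ψ → Γ ⊢ φ ∨f ψ
  ∨E   : ∀ {Γ φ ψ θ} → Γ ⊢ φ ∨f ψ → (φ ∷ Γ) ⊢ θ → (ψ ∷ Γ) ⊢ θ → Γ ⊢ θ

Theory : Set₁
Theory = Form → Set

infix 0 _⊩_
_⊩_ : Theory → Form → Set
T ⊩ φ = Σ[ Γ ∈ List Form ] (All T Γ × (Γ ⊢ φ))

data BaseAx : Form → Set where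
  eq-refl  : BaseAx (∀f (var 0 ≐ var 0))
  eq-sym   : BaseAx (∀f (∀f (var 1 ≐ var 0 ⇒ var 0 ≐ var 1)))
  eq-trans : BaseAx (∀f (∀f (∀f (var 2 ≐ var 1 ⇒ var 1 ≐ var 0 ⇒ var 2 ≐ var 0))))
  S-cong   : BaseAx (∀f (∀f (var 1 ≐ var 0 ⇒ succ (var 1) ≐ succ (var 0))))
  add-cong : BaseAx (∀f (∀f (∀f (∀f (var 3 ≐ var 2 ⇒ var 1 ≐ var 0 ⇒ var 3 ⊕ var 1 ≐ var 2 ⊕ var 0)))))
  mul-cong : BaseAx (∀f (∀f (∀f (∀f (var 3 ≐ var 2 ⇒ var 1 ≐ var 0 ⇒ var 3 ⊗ var 1 ≐ var 2 ⊗ var 0)))))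
  S-disj   : BaseAx (∀f (¬f (succ (var 0) ≐ zer)))
  S-inj    : BaseAx (∀f (∀f (succ (var 1) ≐ succ (var 0) ⇒ var 1 ≐ var 0)))
  add-zero : BaseAx (∀f (zer ⊕ var 0 ≐ var 0))
  add-rec  : BaseAx (∀f (∀f (succ (var 1) ⊕ var 0 ≐ succ (var 1 ⊕ var 0))))
  mul-zero : BaseAx (∀f (zer ⊗ var 0 ≐ zer))
  mul-rec  : BaseAx (∀f (∀f (succ (var 1) ⊗ var 0 ≐ var 0 ⊕ var 1 ⊗ var 0)))

induction : Form → Form
induction φ =
  φ [ zer ·: var ] ⇒ ∀f (φ ⇒ φ [ succ (var 0) ·: ↑ ]) ⇒ ∀f φ

data QAx : Form → Set where
  base   : ∀ {φ} → BaseAx φ → QAx φ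
  q-case : QAx (∀f (var 0 ≐ zer ∨f ∃f (var 1 ≐ succ (var 0))))

data HAAx : Form → Set where
  base : ∀ {φ} → BaseAx φ → HAAx φ
  ind  : ∀ φ → HAAx (induction φ)

record Interp : Set₁ where
  field
    D    : Set
    iO   : D
    iS   : D → D
    iadd : D → D → D
    imul : D → D → D

module Semantics (I : Interp) where
  open Interp I

  _∷ₑ_ : D → (ℕ → D) → ℕ → D
  (d ∷ₑ ρ) zero    = d
  (d ∷ₑ ρ) (suc k) = ρ k

  eval : (ℕ → D) → Term → D
  eval ρ (var k)  = ρ k
  eval ρ zer      = iO
  eval ρ (succ t) = iS (eval ρ t)
  eval ρ (s ⊕ t)  = iadd (eval ρ s) (eval ρ t)
  eval ρ (s ⊗ t)  = imul (eval ρ s) (eval ρ t)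

  sat : (ℕ → D) → Form → Set
  sat ρ ⊥f       = ⊥
  sat ρ (s ≐ t)  = eval ρ s ≡ eval ρ t
  sat ρ (φ ∧f ψ) = sat ρ φ × sat ρ ψ
  sat ρ (φ ∨f ψ) = sat ρ φ ⊎ sat ρ ψ
  sat ρ (φ ⇒ ψ)  = sat ρ φ → sat ρ ψ
  sat ρ (∀f φ)   = (d : D) → sat (d ∷ₑ ρ) φ
  sat ρ (∃f φ)   = Σ[ d ∈ D ] sat (d ∷ₑ ρ) φ

record HAModel : Set₁ where
  field
    interp : Interp
  open Interp interp public
  open Semantics interp public
  field
    sound-ax : ∀ φ → HAAx φ → (ρ : ℕ → D) → sat ρ φ

infix 0 _⊨_
_⊨_ : HAModel → Form → Set
M ⊨ φ = (ρ : ℕ → HAModel.D M) → HAModel.sat M ρ φ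

-- instantiate a binary formula β(x,y) at terms s, t (other variables are
-- parameters shifted by k binders; irrelevant for binary formulas)
inst2 : ℕ → Form → Term → Term → Form
inst2 k β s t = β [ s ·: (t ·: (λ j → var (j + k))) ]

RepΠ : Form → (ℕ → ℕ) → ℕ → Form
RepΠ Π π n = ∀f (inst2 1 Π (num n) (var 0) ⇔ (num (π n) ≐ var 0))

-- x < y := ∃k. S(x+k) = y     (instantiated at terms, under one new binder)
-- Π(u) ∣ c := ∃p. Π(u,p) ∧ p ∣ c,   p ∣ c := ∃k. p × k = c
--
-- ∀e ¬¬ ∃c ∀u. u < n̄ → (α(u,e) ↔ Π(u) ∣ c)
-- inside the body: u = $0, c = $1, e = $2
lemma5p4-formula : Form → Form → ℕ → Form
lemma5p4-formula α Π n =
  ∀f (¬f (¬f (∃f (∀f (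
    ∃f (succ (var 1 ⊕ var 0) ≐ num n)                     -- u < n̄   (k=$0, u=$1)
    ⇒ ( inst2 3 α (var 0) (var 2)                          -- α(u,e)
        ⇔ ∃f ( inst2 4 Π (var 1) (var 0)                   -- Π(u,p)  (p=$0, u=$1, c=$2)
               ∧f ∃f (var 1 ⊗ var 0 ≐ var 3))))))))       -- p ∣ c   (k=$0, p=$1, c=$3)

-- Deciding α(u,e) for the finitely many u < n costs only finitely many
-- instances of excluded middle, so ¬¬ we may take C to be the product of
-- the primes π u over those u < n with α(u,e), i.e. ∀ u < n. α(u,e) ↔ π u ∣ C.
-- In a model of HA every element below a numeral is a numeral, Π defines
-- the graph of π on numerals, and divisibility between numerals agrees with
-- divisibility in ℕ; hence the numeral of C witnesses the existential.

module Submission where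

open import Defs hiding (_⇔_)
import Defs
open import Data.Nat using (ℕ; zero; suc; _+_; _*_; _<_; _≤_; z≤n; s≤s)
open import Data.Nat.Properties
  using (+-comm; *-comm; ≤-refl; <-irrefl; <⇒≤; <⇒≢; n<1+n; m<n⇒m<1+n; m<1+n⇒m<n∨m≡n)
open import Data.Nat.Divisibility using (_∣_; _∤_; divides; ∣-trans; m∣m*n; n∣m*n; ∣1⇒≡1)
open import Data.Nat.Primality using (Prime; ¬prime[1]; euclidsLemma; prime⇒irreducible)
open import Data.List using (map)
open import Data.List.Relation.Unary.All as All using (All; _∷_)
open import Data.List.Relation.Unary.All.Properties using (map⁺)
open import Data.Product using (∃; ∃-syntax; _×_; _,_; proj₁; proj₂)
open import Data.Product.Function.NonDependent.Propositional using (_×-⇔_)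
open import Data.Sum using (_⊎_; inj₁; inj₂; [_,_]′)
open import Data.Sum.Function.Propositional using (_⊎-⇔_)
open import Data.Empty using (⊥-elim)
open import Function.Base using (_∘_)
open import Function.Bundles using (_⇔_; mk⇔; Equivalence)
import Function.Properties.Equivalence as ⇔
open import Function.Related.TypeIsomorphisms using (→-cong-⇔)
open import Function.Definitions using (Injective)
open import Relation.Binary.PropositionalEquality
  using (_≡_; _≢_; _≗_; refl; sym; trans; cong; cong₂; subst; subst₂)
open import Relation.Nullary using (¬_; Dec; yes; no)
open import Relation.Nullary.Negation using (¬¬-Monad; ¬¬-map; contradiction)
open import Relation.Nullary.Decidable using (¬¬-excluded-middle)
open import Effect.Monad using (RawMonad)

open Equivalence using (to; from)

module SemanticsProperties (I : Interp) where
  open Interp I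
  open Semantics I

  ∷ₑ-cong : ∀ {ρ ρ' : ℕ → D} d → ρ ≗ ρ' → d ∷ₑ ρ ≗ d ∷ₑ ρ'
  ∷ₑ-cong d ρ≗ρ' zero    = refl
  ∷ₑ-cong d ρ≗ρ' (suc k) = ρ≗ρ' k

  ∷ₑ-cong-head : ∀ {d d'} (ρ : ℕ → D) → d ≡ d' → d ∷ₑ ρ ≗ d' ∷ₑ ρ
  ∷ₑ-cong-head ρ d≡d' zero    = d≡d'
  ∷ₑ-cong-head ρ d≡d' (suc k) = refl

  eval-cong : ∀ {ρ ρ'} → ρ ≗ ρ' → ∀ t → eval ρ t ≡ eval ρ' t
  eval-cong ρ≗ρ' (var k)  = ρ≗ρ' k
  eval-cong ρ≗ρ' zer      = refl
  eval-cong ρ≗ρ' (succ t) = cong iS (eval-cong ρ≗ρ' t)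
  eval-cong ρ≗ρ' (s ⊕ t)  = cong₂ iadd (eval-cong ρ≗ρ' s) (eval-cong ρ≗ρ' t)
  eval-cong ρ≗ρ' (s ⊗ t)  = cong₂ imul (eval-cong ρ≗ρ' s) (eval-cong ρ≗ρ' t)

  sat-resp : ∀ {ρ ρ'} → ρ ≗ ρ' → ∀ φ → sat ρ φ → sat ρ' φ
  sat-resp ρ≗ρ' ⊥f       ()
  sat-resp ρ≗ρ' (s ≐ t)  = subst₂ _≡_ (eval-cong ρ≗ρ' s) (eval-cong ρ≗ρ' t)
  sat-resp ρ≗ρ' (φ ∧f ψ) (a , b) = sat-resp ρ≗ρ' φ a , sat-resp ρ≗ρ' ψ b
  sat-resp ρ≗ρ' (φ ∨f ψ) (inj₁ a) = inj₁ (sat-resp ρ≗ρ' φ a)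
  sat-resp ρ≗ρ' (φ ∨f ψ) (inj₂ b) = inj₂ (sat-resp ρ≗ρ' ψ b)
  sat-resp ρ≗ρ' (φ ⇒ ψ)  f = sat-resp ρ≗ρ' ψ ∘ f ∘ sat-resp (sym ∘ ρ≗ρ') φ
  sat-resp ρ≗ρ' (∀f φ)   f d = sat-resp (∷ₑ-cong d ρ≗ρ') φ (f d)
  sat-resp ρ≗ρ' (∃f φ)   (d , a) = d , sat-resp (∷ₑ-cong d ρ≗ρ') φ a

  sat-cong : ∀ {ρ ρ'} → ρ ≗ ρ' → ∀ φ → sat ρ φ ⇔ sat ρ' φ
  sat-cong ρ≗ρ' φ = mk⇔ (sat-resp ρ≗ρ' φ) (sat-resp (sym ∘ ρ≗ρ') φ)

  eval-subst : ∀ ρ σ t → eval ρ (t [ σ ]t) ≡ eval (eval ρ ∘ σ) t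
  eval-subst ρ σ (var k)  = refl
  eval-subst ρ σ zer      = refl
  eval-subst ρ σ (succ t) = cong iS (eval-subst ρ σ t)
  eval-subst ρ σ (s ⊕ t)  = cong₂ iadd (eval-subst ρ σ s) (eval-subst ρ σ t)
  eval-subst ρ σ (s ⊗ t)  = cong₂ imul (eval-subst ρ σ s) (eval-subst ρ σ t)

  eval-up : ∀ ρ σ d → eval (d ∷ₑ ρ) ∘ up σ ≗ d ∷ₑ (eval ρ ∘ σ)
  eval-up ρ σ d zero    = refl
  eval-up ρ σ d (suc k) = eval-subst (d ∷ₑ ρ) ↑ (σ k)

  sat-subst    : ∀ ρ σ φ → sat ρ (φ [ σ ]) ⇔ sat (eval ρ ∘ σ) φ
  sat-subst-up : ∀ ρ σ d φ → sat (d ∷ₑ ρ) (φ [ up σ ]) ⇔ sat (d ∷ₑ (eval ρ ∘ σ)) φ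

  sat-subst ρ σ ⊥f       = ⇔.refl
  sat-subst ρ σ (s ≐ t)  = mk⇔ (subst₂ _≡_ (eval-subst ρ σ s) (eval-subst ρ σ t))
                               (subst₂ _≡_ (sym (eval-subst ρ σ s)) (sym (eval-subst ρ σ t)))
  sat-subst ρ σ (φ ∧f ψ) = sat-subst ρ σ φ ×-⇔ sat-subst ρ σ ψ
  sat-subst ρ σ (φ ∨f ψ) = sat-subst ρ σ φ ⊎-⇔ sat-subst ρ σ ψ
  sat-subst ρ σ (φ ⇒ ψ)  = →-cong-⇔ (sat-subst ρ σ φ) (sat-subst ρ σ ψ)
  sat-subst ρ σ (∀f φ)   = mk⇔ (λ f d → to (sat-subst-up ρ σ d φ) (f d))
                               (λ f d → from (sat-subst-up ρ σ d φ) (f d))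
  sat-subst ρ σ (∃f φ)   = mk⇔ (λ (d , a) → d , to (sat-subst-up ρ σ d φ) a)
                               (λ (d , a) → d , from (sat-subst-up ρ σ d φ) a)

  sat-subst-up ρ σ d φ = ⇔.trans (sat-subst (d ∷ₑ ρ) (up σ) φ) (sat-cong (eval-up ρ σ d) φ)

  sat-inst : ∀ ρ t φ → sat ρ (φ [ t ·: var ]) ⇔ sat (eval ρ t ∷ₑ ρ) φ
  sat-inst ρ t φ = ⇔.trans (sat-subst ρ (t ·: var) φ) (sat-cong eval-inst φ)
    where
    eval-inst : eval ρ ∘ (t ·: var) ≗ eval ρ t ∷ₑ ρ
    eval-inst zero    = refl
    eval-inst (suc k) = refl

  sat-shift : ∀ ρ d φ → sat (d ∷ₑ ρ) (shift φ) ⇔ sat ρ φ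
  sat-shift ρ d = sat-subst (d ∷ₑ ρ) ↑

  -- The tail ρ ∘ (k +_), unlike Defs' j + k, computes for a literal k.
  sat-inst2 : ∀ k β s t ρ → sat ρ (inst2 k β s t) ⇔ sat (eval ρ s ∷ₑ (eval ρ t ∷ₑ (ρ ∘ (k +_)))) β
  sat-inst2 k β s t ρ = ⇔.trans (sat-subst ρ _ β) (sat-cong args β)
    where
    args : eval ρ ∘ (s ·: (t ·: (λ j → var (j + k)))) ≗ eval ρ s ∷ₑ (eval ρ t ∷ₑ (ρ ∘ (k +_)))
    args zero          = refl
    args (suc zero)    = refl
    args (suc (suc j)) = cong ρ (+-comm j k)

  sat-shift-All : ∀ ρ d {Γ} → All (sat ρ) Γ → All (sat (d ∷ₑ ρ)) (map shift Γ)
  sat-shift-All ρ d = map⁺ ∘ All.map (from (sat-shift ρ d _))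

  soundness : ∀ {Γ φ} → Γ ⊢ φ → ∀ ρ → All (sat ρ) Γ → sat ρ φ
  soundness (ctx φ∈Γ)  ρ Γ✓ = All.lookup Γ✓ φ∈Γ
  soundness (⇒I d)     ρ Γ✓ = λ a → soundness d ρ (a ∷ Γ✓)
  soundness (⇒E d e)   ρ Γ✓ = soundness d ρ Γ✓ (soundness e ρ Γ✓)
  soundness (∀I d)     ρ Γ✓ = λ x → soundness d (x ∷ₑ ρ) (sat-shift-All ρ x Γ✓)
  soundness (∀E {φ = φ} t d) ρ Γ✓ = from (sat-inst ρ t φ) (soundness d ρ Γ✓ (eval ρ t))
  soundness (∃I {φ = φ} t d) ρ Γ✓ = eval ρ t , to (sat-inst ρ t φ) (soundness d ρ Γ✓)
  soundness (∃E {ψ = ψ} d e) ρ Γ✓ =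
    let (x , a) = soundness d ρ Γ✓
    in  to (sat-shift ρ x ψ) (soundness e (x ∷ₑ ρ) (a ∷ sat-shift-All ρ x Γ✓))
  soundness (⊥E d)     ρ Γ✓ = ⊥-elim (soundness d ρ Γ✓)
  soundness (∧I d e)   ρ Γ✓ = soundness d ρ Γ✓ , soundness e ρ Γ✓
  soundness (∧E₁ d)    ρ Γ✓ = proj₁ (soundness d ρ Γ✓)
  soundness (∧E₂ d)    ρ Γ✓ = proj₂ (soundness d ρ Γ✓)
  soundness (∨I₁ d)    ρ Γ✓ = inj₁ (soundness d ρ Γ✓)
  soundness (∨I₂ d)    ρ Γ✓ = inj₂ (soundness d ρ Γ✓)
  soundness (∨E d e f) ρ Γ✓ = [ (λ a → soundness e ρ (a ∷ Γ✓)) , (λ b → soundness f ρ (b ∷ Γ✓)) ]′ (soundness d ρ Γ✓)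

module HAModelProperties (M : HAModel) where
  open HAModel M
  open SemanticsProperties interp

  valid : ∀ {φ} → BaseAx φ → ∀ ρ → sat ρ φ
  valid ax = sound-ax _ (base ax)

  ρ₀ : ℕ → D
  ρ₀ _ = iO

  iS≢iO : ∀ {x} → iS x ≢ iO
  iS≢iO {x} = valid S-disj ρ₀ x

  iS-injective : ∀ {x y} → iS x ≡ iS y → x ≡ y
  iS-injective {x} {y} = valid S-inj ρ₀ x y

  iadd-zeroˡ : ∀ x → iadd iO x ≡ x
  iadd-zeroˡ = valid add-zero ρ₀

  iadd-sucˡ : ∀ x y → iadd (iS x) y ≡ iS (iadd x y)
  iadd-sucˡ = valid add-rec ρ₀

  imul-zeroˡ : ∀ x → imul iO x ≡ iO
  imul-zeroˡ = valid mul-zero ρ₀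

  imul-sucˡ : ∀ x y → imul (iS x) y ≡ iadd y (imul x y)
  imul-sucˡ = valid mul-rec ρ₀

  zero-or-suc : ∀ x → x ≡ iO ⊎ ∃[ y ] x ≡ iS y
  zero-or-suc = sound-ax _ (ind (var 0 ≐ zer ∨f ∃f (var 1 ≐ succ (var 0)))) ρ₀
                  (inj₁ refl) (λ y _ → inj₂ (y , refl))

  Q-sound : ∀ {φ} → QAx φ → ∀ ρ → sat ρ φ
  Q-sound (base ax) = valid ax
  Q-sound q-case ρ  = zero-or-suc

  ⊩Q-sound : ∀ {φ} → QAx ⊩ φ → ∀ ρ → sat ρ φ
  ⊩Q-sound (Γ , axioms , d) ρ = soundness d ρ (All.map (λ ax → Q-sound ax ρ) axioms)

  ⟦_⟧ : ℕ → D
  ⟦ zero ⟧  = iO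
  ⟦ suc n ⟧ = iS ⟦ n ⟧

  eval-num : ∀ ρ n → eval ρ (num n) ≡ ⟦ n ⟧
  eval-num ρ zero    = refl
  eval-num ρ (suc n) = cong iS (eval-num ρ n)

  ⟦⟧-injective : ∀ {m n} → ⟦ m ⟧ ≡ ⟦ n ⟧ → m ≡ n
  ⟦⟧-injective {zero}  {zero}  _ = refl
  ⟦⟧-injective {zero}  {suc n} e = contradiction (sym e) iS≢iO
  ⟦⟧-injective {suc m} {zero}  e = contradiction e iS≢iO
  ⟦⟧-injective {suc m} {suc n} e = cong suc (⟦⟧-injective (iS-injective e))

  ⟦⟧-+ : ∀ m n → iadd ⟦ m ⟧ ⟦ n ⟧ ≡ ⟦ m + n ⟧
  ⟦⟧-+ zero    n = iadd-zeroˡ ⟦ n ⟧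
  ⟦⟧-+ (suc m) n = trans (iadd-sucˡ ⟦ m ⟧ ⟦ n ⟧) (cong iS (⟦⟧-+ m n))

  ⟦⟧-* : ∀ m n → imul ⟦ m ⟧ ⟦ n ⟧ ≡ ⟦ m * n ⟧
  ⟦⟧-* zero    n = imul-zeroˡ ⟦ n ⟧
  ⟦⟧-* (suc m) n = trans (imul-sucˡ ⟦ m ⟧ ⟦ n ⟧) (trans (cong (iadd ⟦ n ⟧) (⟦⟧-* m n)) (⟦⟧-+ n (m * n)))

  summand-numeral : ∀ n x y → iadd x y ≡ ⟦ n ⟧ → ∃[ m ] m ≤ n × x ≡ ⟦ m ⟧
  summand-numeral n x y x+y≡n with zero-or-suc x
  summand-numeral n       x  y x+y≡n | inj₁ x≡0 = 0 , z≤n , x≡0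
  summand-numeral zero    ._ y x+y≡n | inj₂ (x' , refl) =
    contradiction (trans (sym (iadd-sucˡ x' y)) x+y≡n) iS≢iO
  summand-numeral (suc n) ._ y x+y≡n | inj₂ (x' , refl) =
    let (m , m≤n , x'≡m) = summand-numeral n x' y (iS-injective (trans (sym (iadd-sucˡ x' y)) x+y≡n))
    in  suc m , s≤s m≤n , cong iS x'≡m

  below-numeral : ∀ n x y → iS (iadd x y) ≡ ⟦ n ⟧ → ∃[ m ] m < n × x ≡ ⟦ m ⟧
  below-numeral zero    x y e = contradiction e iS≢iO
  below-numeral (suc n) x y e =
    let (m , m≤n , x≡m) = summand-numeral n x y (iS-injective e) in m , s≤s m≤n , x≡m

  ∣-numeral : ∀ d n → (∃[ k ] imul ⟦ d ⟧ k ≡ ⟦ n ⟧) ⇔ d ∣ n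
  ∣-numeral d n = mk⇔ (reflect d) reify
    where
    reflect : ∀ d → ∃[ k ] imul ⟦ d ⟧ k ≡ ⟦ n ⟧ → d ∣ n
    reflect zero (k , dk≡n) = divides 0 (⟦⟧-injective (trans (sym dk≡n) (imul-zeroˡ k)))
    reflect (suc d) (k , dk≡n) =
      let (q , _ , k≡q) = summand-numeral n k (imul ⟦ d ⟧ k) (trans (sym (imul-sucˡ ⟦ d ⟧ k)) dk≡n)
          dq≡n = trans (sym (⟦⟧-* (suc d) q)) (subst (λ k → imul ⟦ suc d ⟧ k ≡ ⟦ n ⟧) k≡q dk≡n)
      in  divides q (trans (sym (⟦⟧-injective dq≡n)) (*-comm (suc d) q))
    reify : d ∣ n → ∃[ k ] imul ⟦ d ⟧ k ≡ ⟦ n ⟧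
    reify (divides q refl) = ⟦ q ⟧ , trans (⟦⟧-* d q) (cong ⟦_⟧ (*-comm d q))

module PrimeCoding {π : ℕ → ℕ} (π-injective : Injective _≡_ _≡_ π) (π-prime : ∀ n → Prime (π n)) where

  π∤1 : ∀ m → π m ∤ 1
  π∤1 m πm∣1 = ¬prime[1] (subst Prime (∣1⇒≡1 πm∣1) (π-prime m))

  π-∣-injective : ∀ {m n} → π m ∣ π n → m ≡ n
  π-∣-injective {m} {n} πm∣πn =
    [ (λ πm≡1 → ⊥-elim (¬prime[1] (subst Prime πm≡1 (π-prime m)))) , π-injective ]′
      (prime⇒irreducible (π-prime n) πm∣πn)

  module _ {A : ℕ → Set} where

    -- The second component supplies π n ∤ C when the code is extended past an n with ¬ A n.
    Codes : ℕ → ℕ → Set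
    Codes n C = (∀ m → m < n → A m ⇔ π m ∣ C) × (∀ m → n ≤ m → π m ∤ C)

    codes-zero : Codes 0 1
    codes-zero = (λ _ ()) , (λ m _ → π∤1 m)

    codes-suc-yes : ∀ {n C} → Codes n C → A n → Codes (suc n) (C * π n)
    codes-suc-yes {n} {C} (below , above) a = below′ , above′
      where
      below′ : ∀ m → m < suc n → A m ⇔ π m ∣ C * π n
      below′ m m<1+n with m<1+n⇒m<n∨m≡n m<1+n
      ... | inj₂ refl = mk⇔ (λ _ → n∣m*n C) (λ _ → a)
      ... | inj₁ m<n  = mk⇔ (λ am → ∣-trans (to (below m m<n) am) (m∣m*n (π n)))
                            ([ from (below m m<n) , (λ πm∣πn → contradiction (π-∣-injective πm∣πn) (<⇒≢ m<n)) ]′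
                               ∘ euclidsLemma C (π n) (π-prime m))
      above′ : ∀ m → suc n ≤ m → π m ∤ C * π n
      above′ m n<m = [ above m (<⇒≤ n<m) , (λ πm∣πn → <-irrefl (sym (π-∣-injective πm∣πn)) n<m) ]′
                       ∘ euclidsLemma C (π n) (π-prime m)

    codes-suc-no : ∀ {n C} → Codes n C → ¬ A n → Codes (suc n) C
    codes-suc-no {n} {C} (below , above) ¬a = below′ , (λ m n<m → above m (<⇒≤ n<m))
      where
      below′ : ∀ m → m < suc n → A m ⇔ π m ∣ C
      below′ m m<1+n with m<1+n⇒m<n∨m≡n m<1+n
      ... | inj₂ refl = mk⇔ (⊥-elim ∘ ¬a) (⊥-elim ∘ above n ≤-refl)
      ... | inj₁ m<n  = below m m<n

    code : ∀ n → (∀ m → m < n → Dec (A m)) → ∃ (Codes n)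
    code zero    _   = 1 , codes-zero
    code (suc n) dec with code n (λ m m<n → dec m (m<n⇒m<1+n m<n)) | dec n (n<1+n n)
    ... | C , codes | yes a  = C * π n , codes-suc-yes codes a
    ... | C , codes | no  ¬a = C , codes-suc-no codes ¬a

    ¬¬-Dec-below : ∀ n → ¬ ¬ (∀ m → m < n → Dec (A m))
    ¬¬-Dec-below zero = λ ¬dec → ¬dec (λ _ ())
    ¬¬-Dec-below (suc n) = do
        dec  ← ¬¬-Dec-below n
        decₙ ← ¬¬-excluded-middle
        pure (extend dec decₙ)
      where
      open RawMonad ¬¬-Monad
      extend : (∀ m → m < n → Dec (A m)) → Dec (A n) → ∀ m → m < suc n → Dec (A m)
      extend dec decₙ m m<1+n with m<1+n⇒m<n∨m≡n m<1+n
      ... | inj₁ m<n = dec m m<n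
      ... | inj₂ refl = decₙ

    codable : ∀ n → ¬ ¬ ∃ (Codes n)
    codable n = ¬¬-map (code n) (¬¬-Dec-below n)

module Representation {π : ℕ → ℕ} {Π : Form} (rep : ∀ n → QAx ⊩ RepΠ Π π n) (M : HAModel) where
  open HAModel M
  open SemanticsProperties interp
  open HAModelProperties M

  Π-graph : ∀ ρ m p → sat (⟦ m ⟧ ∷ₑ (p ∷ₑ ρ)) Π ⇔ ⟦ π m ⟧ ≡ p
  Π-graph ρ m p = ⇔.trans (⇔.sym Π-inst) (⇔.trans (mk⇔ (proj₁ Πm↔πm) (proj₂ Πm↔πm)) eval-π)
    where
    Πm↔πm = ⊩Q-sound (rep m) ρ p
    Π-inst : sat (p ∷ₑ ρ) (inst2 1 Π (num m) (var 0)) ⇔ sat (⟦ m ⟧ ∷ₑ (p ∷ₑ ρ)) Π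
    Π-inst = ⇔.trans (sat-inst2 1 Π (num m) (var 0) (p ∷ₑ ρ))
                     (sat-cong (∷ₑ-cong-head (p ∷ₑ ρ) (eval-num (p ∷ₑ ρ) m)) Π)
    eval-π : (eval (p ∷ₑ ρ) (num (π m)) ≡ p) ⇔ (⟦ π m ⟧ ≡ p)
    eval-π = mk⇔ (trans (sym (eval-num _ (π m)))) (trans (eval-num _ (π m)))

  -- Π(u) ∣ c with u = $0 and c = $1, as it occurs in lemma5p4-formula.
  Π∣ : Form
  Π∣ = ∃f (inst2 4 Π (var 1) (var 0) ∧f ∃f (var 1 ⊗ var 0 ≐ var 3))

  Π∣-numeral : ∀ ρ m C → sat (⟦ m ⟧ ∷ₑ (⟦ C ⟧ ∷ₑ ρ)) Π∣ ⇔ π m ∣ C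
  Π∣-numeral ρ m C = mk⇔ reflect reify
    where
    Π-at : ∀ p → sat (p ∷ₑ (⟦ m ⟧ ∷ₑ (⟦ C ⟧ ∷ₑ ρ))) (inst2 4 Π (var 1) (var 0)) ⇔ ⟦ π m ⟧ ≡ p
    Π-at p = ⇔.trans (sat-inst2 4 Π (var 1) (var 0) _) (Π-graph (ρ ∘ suc) m p)
    reflect : sat (⟦ m ⟧ ∷ₑ (⟦ C ⟧ ∷ₑ ρ)) Π∣ → π m ∣ C
    reflect (p , Πmp , k , pk≡C) =
      to (∣-numeral (π m) C) (k , subst (λ q → imul q k ≡ ⟦ C ⟧) (sym (to (Π-at p) Πmp)) pk≡C)
    reify : π m ∣ C → sat (⟦ m ⟧ ∷ₑ (⟦ C ⟧ ∷ₑ ρ)) Π∣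
    reify πm∣C = ⟦ π m ⟧ , from (Π-at _) refl , from (∣-numeral (π m) C) πm∣C

lemma5p4 : (π : ℕ → ℕ) → Injective _≡_ _≡_ π → (∀ n → Prime (π n))
    → (Π : Form) → Binary Π → (∀ n → (QAx ⊩ RepΠ Π π n))
    → (M : HAModel) → (α : Form) → Binary α → (n : ℕ)
    → M ⊨ lemma5p4-formula α Π n
lemma5p4 π π-injective π-prime Π _ rep M α _ n ρ e =
  ¬¬-map (λ (C , codes) → ⟦ C ⟧ , coded codes) (codable n)
  where
  open HAModel M
  open SemanticsProperties interp
  open HAModelProperties M
  open PrimeCoding π-injective π-prime
  open Representation rep M

  α-at : ℕ → Set
  α-at m = sat (⟦ m ⟧ ∷ₑ (e ∷ₑ ρ)) α

  coded : ∀ {C} → Codes {α-at} n C → ∀ u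
        → sat (u ∷ₑ (⟦ C ⟧ ∷ₑ (e ∷ₑ ρ))) (∃f (succ (var 1 ⊕ var 0) ≐ num n))
        → sat (u ∷ₑ (⟦ C ⟧ ∷ₑ (e ∷ₑ ρ))) (inst2 3 α (var 0) (var 2) Defs.⇔ Π∣)
  coded {C} (below , _) u (k , u<n) with below-numeral n u k (trans u<n (eval-num _ n))
  ... | m , m<n , refl = to α↔Π∣ , from α↔Π∣
    where
    α↔Π∣ = ⇔.trans (sat-inst2 3 α (var 0) (var 2) _)
                   (⇔.trans (below m m<n) (⇔.sym (Π∣-numeral (e ∷ₑ ρ) m C)))
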